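{- Let $\overline{\mathcal{F}}$ be the set of overpartitions in which the first occurrence of a number may be overlined and no two adjacent parts are both overlined. Then $\overline{\mathcal{F}}$ is a separable overpartition class.
   Context: An overpartition (in the "first occurrence" convention) is a partition in which the first occurrence of a number may be overlined; parts are listed in non-increasing order of size, with $\overline{t}$ listed before the non-overlined copies of $t$. Adjacency refers to positions in this list. For a positive integer $t$ and nonnegative integer $d$, $\overline{t}+d=\overline{t+d}$. A separable overpartition class is a set $\mathcal{P}$ of overpartitions for which there is a subset $\mathcal{B}\subset\mathcal{P}$ (the basis) such that for each $m\geq 1$ the number of overpartitions in $\mathcal{B}$ with $m$ parts is finite, every overpartition in $\mathcal{P}$ with $m$ parts is uniquely of the form $(b_1+\pi_1,\ldots,b_m+\pi_m)$ with $(b_1,\ldots,b_m)\in\mathcal{B}$ and $(\pi_1,\ldots,\pi_m)$ a non-increasing sequence of nonnegative integers, and all overpartitions of this form lie in $\mathcal{P}$. -}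

module Defs where

open import Level using (Level)
open import Data.Nat using (ℕ; _+_; _≤_; _<_)
open import Data.Bool using (Bool; true; false)
open import Data.Product using (_×_; _,_; proj₁; proj₂; Σ-syntax)
open import Data.Sum using (_⊎_)
open import Data.Unit using (⊤)
open import Data.Vec using (Vec; []; _∷_; zipWith)
open import Data.Vec.Relation.Unary.All using (All)
open import Data.List using (List)
open import Data.List.Membership.Propositional using (_∈_)
open import Relation.Binary.PropositionalEquality using (_≡_)
open import Relation.Nullary using (¬_)

-- A part of an overpartition: its size t and whether it is overlined.
Part : Set
Part = ℕ × Bool

Chain : {A : Set} → (A → A → Set) → {n : ℕ} → Vec A n → Set
Chain R [] = ⊤
Chain R (x ∷ []) = ⊤
Chain R (x ∷ y ∷ xs) = R x y × Chain R (y ∷ xs)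

-- Ordering of adjacent parts (p listed before q): sizes non-increasing,
-- and if equal then q is not overlined (only the first occurrence of a
-- number may be overlined, and t-bar is listed before the plain t's).
OverOrder : Part → Part → Set
OverOrder (a , oa) (b , ob) = (b < a) ⊎ ((a ≡ b) × (ob ≡ false))

IsOverpartition : {m : ℕ} → Vec Part m → Set
IsOverpartition v = All (λ p → 1 ≤ proj₁ p) v × Chain OverOrder v

Fbar : {m : ℕ} → Vec Part m → Set
Fbar v = IsOverpartition v × Chain (λ p q → ¬ ((proj₂ p ≡ true) × (proj₂ q ≡ true))) v

NonIncreasing : {m : ℕ} → Vec ℕ m → Set
NonIncreasing π = Chain (λ x y → y ≤ x) π

addSeq : {m : ℕ} → Vec Part m → Vec ℕ m → Vec Part m
addSeq = zipWith (λ p d → (proj₁ p + d , proj₂ p))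

OverClass : Set₁
OverClass = {m : ℕ} → Vec Part m → Set

IsBasis : OverClass → OverClass → Set
IsBasis P B =
    (∀ {m} (b : Vec Part m) → B b → P b)
  × (∀ (m : ℕ) → 1 ≤ m →
       Σ[ L ∈ List (Vec Part m) ] (∀ (b : Vec Part m) → B b → b ∈ L))
  × (∀ (m : ℕ) → 1 ≤ m → (λs : Vec Part m) → P λs →
       Σ[ b ∈ Vec Part m ] Σ[ π ∈ Vec ℕ m ]
         ((B b × NonIncreasing π × addSeq b π ≡ λs)
         × (∀ (b' : Vec Part m) (π' : Vec ℕ m) →
              B b' → NonIncreasing π' → addSeq b' π' ≡ λs →
              (b' ≡ b) × (π' ≡ π))))
  × (∀ (m : ℕ) → 1 ≤ m → (b : Vec Part m) (π : Vec ℕ m) →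
       B b → NonIncreasing π → P (addSeq b π))

IsSeparable : OverClass → Set₁
IsSeparable P =
    (∀ {m} (v : Vec Part m) → P v → IsOverpartition v)
  × Σ[ B ∈ OverClass ] IsBasis P B

{-# OPTIONS --safe #-}
-- Consecutive parts (a , o) , (b , o') are correctly ordered iff a ≥ b + [o'], where [o'] is 1
-- if o' is overlined and 0 otherwise. So the smallest overpartition with overline pattern f,
-- minimal f, has as its j-th part 1 + the number of overlined parts after position j, and the
-- overpartitions with pattern f are exactly minimal f + π for non-increasing π ≥ 0, the slack
-- a - b - [o'] of consecutive parts being the step π_j - π_{j+1}. Adding π does not move the
-- overlines, so "no two adjacent parts overlined" is a condition on the pattern f alone.
module Submission where

open import Defs
open import Data.Nat using (ℕ; zero; suc; _+_; _≤_; z≤n; s≤s)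
open import Data.Nat.Properties
  using ( ≤-refl; <⇒≤; m≤m+n; m≤n⇒m<n∨m≡n; m≤n⇒∃[o]m+o≡n; +-monoʳ-≤; +-identityʳ; +-assoc
        ; +-cancelˡ-≡; module ≤-Reasoning)
open import Data.Nat.Tactic.RingSolver using (solve-∀)
open import Data.Bool using (Bool; true; false)
open import Data.Product using (_×_; _,_; proj₁; proj₂; Σ-syntax)
open import Data.Sum using (inj₁; inj₂)
open import Data.Unit using (tt)
open import Data.Vec using (Vec; []; _∷_; map; replicate)
open import Data.Vec.Properties using (∷-injective)
open import Data.Vec.Relation.Unary.All using (All; []; _∷_)
open import Data.List using (List; [_]; cartesianProductWith)
import Data.List as List
open import Data.List.Relation.Unary.Any using (here; there)
open import Data.List.Membership.Propositional using (_∈_)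
open import Data.List.Membership.Propositional.Properties using (∈-map⁺; ∈-cartesianProductWith⁺)
open import Function using (_on_)
open import Relation.Binary.Definitions using (Reflexive)
open import Relation.Binary.PropositionalEquality
  using (_≡_; refl; sym; trans; subst; cong; cong₂; module ≡-Reasoning)
open import Relation.Nullary using (¬_)

private
  variable
    A C : Set
    n : ℕ

Chain-map⁺ : ∀ (g : A → C) {R : C → C → Set} (v : Vec A n) →
             Chain (R on g) v → Chain R (map g v)
Chain-map⁺ g []           _       = tt
Chain-map⁺ g (x ∷ [])     _       = tt
Chain-map⁺ g (x ∷ y ∷ v) (r , c) = r , Chain-map⁺ g (y ∷ v) c

Chain-map⁻ : ∀ (g : A → C) {R : C → C → Set} (v : Vec A n) →
             Chain R (map g v) → Chain (R on g) v
Chain-map⁻ g []           _       = tt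
Chain-map⁻ g (x ∷ [])     _       = tt
Chain-map⁻ g (x ∷ y ∷ v) (r , c) = r , Chain-map⁻ g (y ∷ v) c

Chain-replicate : ∀ {R : A → A → Set} → Reflexive R → ∀ n {x : A} → Chain R (replicate n x)
Chain-replicate refl-R zero          = tt
Chain-replicate refl-R (suc zero)    = tt
Chain-replicate refl-R (suc (suc n)) = refl-R , Chain-replicate refl-R (suc n)

vectors : List A → ∀ n → List (Vec A n)
vectors xs zero    = [ [] ]
vectors xs (suc n) = cartesianProductWith _∷_ xs (vectors xs n)

∈-vectors : ∀ {xs : List A} → (∀ x → x ∈ xs) → (v : Vec A n) → v ∈ vectors xs n
∈-vectors all∈ []      = here refl
∈-vectors all∈ (x ∷ v) = ∈-cartesianProductWith⁺ _∷_ (all∈ x) (∈-vectors all∈ v)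

∈-booleans : ∀ x → x ∈ true List.∷ false List.∷ List.[]
∈-booleans true  = here refl
∈-booleans false = there (here refl)

toℕ : Bool → ℕ
toℕ false = 0
toℕ true  = 1

countTrue : Vec Bool n → ℕ
countTrue []      = 0
countTrue (o ∷ f) = toℕ o + countTrue f

overlines : Vec Part n → Vec Bool n
overlines = map proj₂

minimal : Vec Bool n → Vec Part n
minimal []      = []
minimal (o ∷ f) = (suc (countTrue f) , o) ∷ minimal f

OverOrder⇒≤ : ∀ {p q} → OverOrder p q → toℕ (proj₂ q) + proj₁ q ≤ proj₁ p
OverOrder⇒≤ {q = b , true}  (inj₁ b<a)           = b<a
OverOrder⇒≤ {q = b , false} (inj₁ b<a)           = <⇒≤ b<a
OverOrder⇒≤                 (inj₂ (refl , refl)) = ≤-refl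

≤⇒OverOrder : ∀ {p q} → toℕ (proj₂ q) + proj₁ q ≤ proj₁ p → OverOrder p q
≤⇒OverOrder {q = b , true}  b<a = inj₁ b<a
≤⇒OverOrder {q = b , false} b≤a with m≤n⇒m<n∨m≡n b≤a
... | inj₁ b<a  = inj₁ b<a
... | inj₂ refl = inj₂ (refl , refl)

+-suc-assoc : ∀ t c d → t + (suc c + d) ≡ suc (t + c) + d
+-suc-assoc = solve-∀

overlines-minimal : (f : Vec Bool n) → overlines (minimal f) ≡ f
overlines-minimal []      = refl
overlines-minimal (o ∷ f) = cong (o ∷_) (overlines-minimal f)

overlines-addSeq : (b : Vec Part n) (π : Vec ℕ n) → overlines (addSeq b π) ≡ overlines b
overlines-addSeq []            []      = refl
overlines-addSeq ((a , o) ∷ b) (d ∷ π) = cong (o ∷_) (overlines-addSeq b π)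

addSeq-identityʳ : (b : Vec Part n) → addSeq b (replicate n 0) ≡ b
addSeq-identityʳ []            = refl
addSeq-identityʳ ((a , o) ∷ b) = cong₂ _∷_ (cong (_, o) (+-identityʳ a)) (addSeq-identityʳ b)

addSeq-cancelˡ : (b : Vec Part n) (π π' : Vec ℕ n) → addSeq b π ≡ addSeq b π' → π ≡ π'
addSeq-cancelˡ []            []      []        _  = refl
addSeq-cancelˡ ((a , o) ∷ b) (d ∷ π) (d' ∷ π') eq =
  let head≡ , tail≡ = ∷-injective eq
  in cong₂ _∷_ (+-cancelˡ-≡ a d d' (cong proj₁ head≡)) (addSeq-cancelˡ b π π' tail≡)

addSeq-minimal-injective : (f f' : Vec Bool n) (π π' : Vec ℕ n) →
                           addSeq (minimal f) π ≡ addSeq (minimal f') π' → f ≡ f' × π ≡ π'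
addSeq-minimal-injective f f' π π' eq =
  f≡f' , addSeq-cancelˡ (minimal f') π π' (subst (λ g → addSeq (minimal g) π ≡ _) f≡f' eq)
  where
  open ≡-Reasoning
  f≡f' : f ≡ f'
  f≡f' = begin
    f                                    ≡⟨ sym (overlines-minimal f) ⟩
    overlines (minimal f)                ≡⟨ sym (overlines-addSeq (minimal f) π) ⟩
    overlines (addSeq (minimal f) π)     ≡⟨ cong overlines eq ⟩
    overlines (addSeq (minimal f') π')   ≡⟨ overlines-addSeq (minimal f') π' ⟩
    overlines (minimal f')               ≡⟨ overlines-minimal f' ⟩
    f'                                   ∎

addSeq-minimal-positive : (f : Vec Bool n) (π : Vec ℕ n) →
                          All (λ p → 1 ≤ proj₁ p) (addSeq (minimal f) π)
addSeq-minimal-positive []      []      = []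
addSeq-minimal-positive (o ∷ f) (d ∷ π) = s≤s z≤n ∷ addSeq-minimal-positive f π

addSeq-minimal-ordered : (f : Vec Bool n) (π : Vec ℕ n) → NonIncreasing π →
                         Chain OverOrder (addSeq (minimal f) π)
addSeq-minimal-ordered []           []           _           = tt
addSeq-minimal-ordered (o ∷ [])     (d ∷ [])     _           = tt
addSeq-minimal-ordered (o ∷ o' ∷ f) (d ∷ d' ∷ π) (d'≤d , ni) =
  ≤⇒OverOrder {_ , o} gap , addSeq-minimal-ordered (o' ∷ f) (d' ∷ π) ni
  where
  open ≤-Reasoning
  c : ℕ
  c = countTrue f
  gap : toℕ o' + (suc c + d') ≤ suc (toℕ o' + c) + d
  gap = begin
    toℕ o' + (suc c + d')  ≡⟨ +-suc-assoc (toℕ o') c d' ⟩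
    suc (toℕ o' + c) + d'  ≤⟨ +-monoʳ-≤ (suc (toℕ o' + c)) d'≤d ⟩
    suc (toℕ o' + c) + d   ∎

decompose : (λs : Vec Part n) → IsOverpartition λs →
            Σ[ π ∈ Vec ℕ n ] (NonIncreasing π × addSeq (minimal (overlines λs)) π ≡ λs)
decompose []                  _                    = [] , tt , refl
decompose ((zero  , o) ∷ [])  (() ∷ [] , _)
decompose ((suc a , o) ∷ [])  _                    = a ∷ [] , tt , refl
decompose ((a , o) ∷ (b , o') ∷ λs) (_ ∷ pos , ord , ch)
  with decompose ((b , o') ∷ λs) (pos , ch) | m≤n⇒∃[o]m+o≡n (OverOrder⇒≤ {a , o} ord)
... | d ∷ π , ni , eq | k , gap =
  d + k ∷ d ∷ π , (m≤m+n d k , ni) , cong₂ _∷_ (cong (_, o) head≡) eq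
  where
  open ≡-Reasoning
  c : ℕ
  c = countTrue (overlines λs)
  next≡ : suc c + d ≡ b
  next≡ = cong proj₁ (proj₁ (∷-injective eq))
  head≡ : suc (toℕ o' + c) + (d + k) ≡ a
  head≡ = begin
    suc (toℕ o' + c) + (d + k)   ≡⟨ sym (+-assoc (suc (toℕ o' + c)) d k) ⟩
    suc (toℕ o' + c) + d + k     ≡⟨ cong (_+ k) (sym (+-suc-assoc (toℕ o') c d)) ⟩
    toℕ o' + (suc c + d) + k     ≡⟨ cong (λ x → toℕ o' + x + k) next≡ ⟩
    toℕ o' + b + k               ≡⟨ gap ⟩
    a                            ∎

NotBothTrue : Bool → Bool → Set
NotBothTrue x y = ¬ (x ≡ true × y ≡ true)

FbarBasis : OverClass
FbarBasis {m} b = Σ[ f ∈ Vec Bool m ] (Chain NotBothTrue f × b ≡ minimal f)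

Fbar-addSeq : (b : Vec Part n) (π : Vec ℕ n) → FbarBasis b → NonIncreasing π → Fbar (addSeq b π)
Fbar-addSeq _ π (f , noAdjacent , refl) ni =
    (addSeq-minimal-positive f π , addSeq-minimal-ordered f π ni)
  , Chain-map⁻ proj₂ (addSeq (minimal f) π) (subst (Chain NotBothTrue) (sym overlines≡f) noAdjacent)
  where
  overlines≡f : overlines (addSeq (minimal f) π) ≡ f
  overlines≡f = trans (overlines-addSeq (minimal f) π) (overlines-minimal f)

FbarBasis⊆Fbar : (b : Vec Part n) → FbarBasis b → Fbar b
FbarBasis⊆Fbar {n} b b∈B =
  subst Fbar (addSeq-identityʳ b) (Fbar-addSeq b (replicate n 0) b∈B (Chain-replicate ≤-refl n))

FbarBasis-finite : ∀ m → Σ[ L ∈ List (Vec Part m) ] (∀ b → FbarBasis b → b ∈ L)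
FbarBasis-finite m =
  List.map minimal (vectors _ m) , λ { _ (f , _ , refl) → ∈-map⁺ minimal (∈-vectors ∈-booleans f) }

Fbar-decomposition : (λs : Vec Part n) → Fbar λs →
  Σ[ b ∈ Vec Part n ] Σ[ π ∈ Vec ℕ n ]
    ((FbarBasis b × NonIncreasing π × addSeq b π ≡ λs)
    × (∀ b' π' → FbarBasis b' → NonIncreasing π' → addSeq b' π' ≡ λs → b' ≡ b × π' ≡ π))
Fbar-decomposition λs (isOver , noAdjacent) =
  let π , ni , eq = decompose λs isOver
  in  minimal (overlines λs) , π
    , ((overlines λs , Chain-map⁺ proj₂ λs noAdjacent , refl) , ni , eq)
    , λ { _ π' (f' , _ , refl) _ eq' →
            let f'≡ , π'≡ = addSeq-minimal-injective f' (overlines λs) π' π (trans eq' (sym eq))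
            in  cong minimal f'≡ , π'≡ }

theorem5p1 : IsSeparable Fbar
theorem5p1 =
    (λ _ → proj₁)
  , FbarBasis
  , FbarBasis⊆Fbar
  , (λ m _ → FbarBasis-finite m)
  , (λ m _ → Fbar-decomposition)
  , (λ m _ → Fbar-addSeq)
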